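{- Let $G$ be a finite abelian group of order $v$ and let $\{D_1,\dots,D_m\}$ be a nontrivial $(v,m,k,\lambda)$-SEDF in $G$ such that $1\notin\bigcup_{i=1}^m D_i$. Then for each $j$ with $1\le j\le m$, neither $D_j\cup\{1\}$ nor $G\setminus D_j$ is a subgroup of $G$.
   Context: Groups are finite abelian, written multiplicatively with identity $1$. For a subset $A\subseteq G$ we also write $A$ for the group ring element $\sum_{a\in A}a\in\mathbb{Z}[G]$ and $A^{(-1)}=\sum_{a\in A}a^{ -1}$. Given integers $m\ge 2$, $k\ge1$, $\lambda\ge 1$ and a group $G$ of order $v$, a collection $\{D_1,\dots,D_m\}$ of mutually disjoint $k$-subsets of $G$ is a $(v,m,k,\lambda)$-strong external difference family (SEDF) in $G$ if $D_j\sum_{1\le i\le m,\, i\ne j}D_i^{(-1)}=\lambda(G-1)$ in $\mathbb{Z}[G]$ for each $j$. The SEDF is trivial if $k=1$ and nontrivial if $k>1$. -}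

module Defs where

open import Level using (0ℓ)
open import Data.Nat using (ℕ; _+_; _*_; _≤_)
open import Data.Bool using (Bool; true; false; if_then_else_; _∨_; not)
open import Data.List using (List; length; map; filter; allFin)
open import Data.Nat.ListAction using (sum)
open import Data.Fin using (Fin)
open import Data.Product using (_×_)
open import Relation.Nullary using (¬_; does)
open import Relation.Binary.PropositionalEquality using (_≡_; _≢_)
open import Relation.Binary.Definitions using (DecidableEquality)
open import Algebra.Structures using (IsAbelianGroup)
open import Data.List.Membership.Propositional using (_∈_)
open import Data.List.Relation.Unary.Unique.Propositional using (Unique)

record FinAbGroup : Set₁ where
  infixl 7 _∙_
  field
    Carrier        : Set
    _∙_            : Carrier → Carrier → Carrier
    ε              : Carrier
    _⁻¹            : Carrier → Carrier
    isAbelianGroup : IsAbelianGroup _≡_ _∙_ ε _⁻¹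
    _≟_            : DecidableEquality Carrier
    elems          : List Carrier
    elems-unique   : Unique elems
    elems-complete : ∀ x → x ∈ elems

  order : ℕ
  order = length elems

  Subset : Set
  Subset = Carrier → Bool

  ∣_∣ : Subset → ℕ
  ∣ A ∣ = length (filter (λ x → A x Data.Bool.≟ true) elems)

  -- group ring ℤ[G] elements with nonnegative coefficients: coefficient functions
  GR : Set
  GR = Carrier → ℕ

  ⟦_⟧ : Subset → GR
  ⟦ A ⟧ x = if A x then 1 else 0

  _⁽⁻¹⁾ : GR → GR
  (f ⁽⁻¹⁾) x = f (x ⁻¹)

  _⊛_ : GR → GR → GR
  (f ⊛ h) g = sum (map (λ a → f a * h (a ⁻¹ ∙ g)) elems)

  λ[G-1] : ℕ → GR
  λ[G-1] l g = if does (g ≟ ε) then 0 else l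

  othersInv : {m : ℕ} → (Fin m → Subset) → Fin m → GR
  othersInv {m} D j g =
    sum (map (λ i → if does (i Data.Fin.≟ j) then 0 else (⟦ D i ⟧ ⁽⁻¹⁾) g) (allFin m))

  record IsSEDF (v m k l : ℕ) (D : Fin m → Subset) : Set where
    field
      order≡v  : order ≡ v
      2≤m      : 2 ≤ m
      1≤k      : 1 ≤ k
      1≤l      : 1 ≤ l
      size     : ∀ i → ∣ D i ∣ ≡ k
      disjoint : ∀ i j → i ≢ j → ∀ x → D i x ≡ true → D j x ≡ false
      equation : ∀ j g → (⟦ D j ⟧ ⊛ othersInv D j) g ≡ λ[G-1] l g

  IsSubgroup : Subset → Set
  IsSubgroup S = (S ε ≡ true)
               × (∀ x y → S x ≡ true → S y ≡ true → S (x ∙ y) ≡ true)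
               × (∀ x → S x ≡ true → S (x ⁻¹) ≡ true)

  withOne : Subset → Subset
  withOne A x = A x ∨ does (x ≟ ε)

  compl : Subset → Subset
  compl A x = not (A x)

-- If D_j ∪ {1} is a subgroup H, pick a ∈ D_j: every x ∈ D_j gives x⁻¹a ∈ H, so the
-- partner y with x y⁻¹ = a lies in D_j ∪ {1} and hence in no other D_i; thus a ≠ 1 has
-- coefficient 0 in D_j Σ_{i≠j} D_i^(-1), contradicting λ ≥ 1. If G \ D_j is a subgroup
-- K, pick c in some D_i with i ≠ j, so c ∈ K: a partner y ∈ D_i ⊆ K of x ∈ D_j would
-- force x = c y ∈ K, so again c has coefficient 0.
module Submission where

open import Defs
open import Data.Nat using (ℕ; _+_; _*_; _<_; _≤_; s≤s; z≤n)
open import Data.Nat.Properties using (*-identityˡ)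
open import Data.Nat.ListAction using (sum)
open import Data.Fin using (Fin; zero; punchIn)
import Data.Fin as Fin
open import Data.Fin.Properties using (punchInᵢ≢i)
open import Data.Bool using (true; false; if_then_else_; not; _∨_)
open import Data.Bool.Properties using (¬-not; not-¬)
import Data.Bool as Bool
open import Data.List using ([]; _∷_; map; filter; allFin)
open import Data.List.Membership.Propositional.Properties using (∈-filter⁻)
open import Data.List.Membership.Propositional using (_∈_)
open import Data.List.Relation.Unary.Any using (here)
open import Data.Product using (_×_; _,_; ∃; proj₂)
open import Data.Sum using (_⊎_; inj₁; inj₂)
open import Relation.Nullary using (¬_; yes; no; does; contradiction)
open import Relation.Binary.PropositionalEquality
open import Algebra.Bundles using (Group)
open import Algebra.Structures using (IsAbelianGroup)
import Algebra.Properties.Group as GroupProperties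

sum-map-≡0 : {A : Set} {f : A → ℕ} → (∀ x → f x ≡ 0) → ∀ xs → sum (map f xs) ≡ 0
sum-map-≡0 f≡0 []       = refl
sum-map-≡0 f≡0 (x ∷ xs) = cong₂ _+_ (f≡0 x) (sum-map-≡0 f≡0 xs)

other-index : ∀ {m} → 2 ≤ m → (j : Fin m) → ∃ λ i → i ≢ j
other-index (s≤s (s≤s z≤n)) j = punchIn j zero , punchInᵢ≢i j zero

module _ (G : FinAbGroup) where
  open FinAbGroup G

  group : Group _ _
  group = record { isGroup = IsAbelianGroup.isGroup isAbelianGroup }

  open GroupProperties group using (⁻¹-anti-homo-\\; \\-leftDividesˡ)

  1≤∣∣⇒member : (A : Subset) → 1 ≤ ∣ A ∣ → ∃ λ x → A x ≡ true
  1≤∣∣⇒member A 1≤∣A∣ with filter (λ x → A x Bool.≟ true) elems in eq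
  1≤∣∣⇒member A ()     | []
  1≤∣∣⇒member A 1≤∣A∣ | x ∷ _ =
    x , proj₂ (∈-filter⁻ (λ x → A x Bool.≟ true) {xs = elems} (subst (x ∈_) (sym eq) (here refl)))

  withOne-true⁻ : ∀ A y → withOne A y ≡ true → A y ≡ true ⊎ y ≡ ε
  withOne-true⁻ A y h with A y | y ≟ ε
  ... | true  | _        = inj₁ refl
  ... | false | yes y≡ε  = inj₂ y≡ε
  withOne-true⁻ A y () | false | no _

  compl-true⁻ : ∀ A y → compl A y ≡ true → A y ≡ false
  compl-true⁻ A y h with A y
  ... | false = refl
  compl-true⁻ A y () | true

  -- (x⁻¹ g)⁻¹ is the partner y of x with x y⁻¹ = g.
  subgroup-partner : ∀ {S} → IsSubgroup S → ∀ {x g} →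
                     S x ≡ true → S g ≡ true → S ((x ⁻¹ ∙ g) ⁻¹) ≡ true
  subgroup-partner (_ , ∙-closed , ⁻¹-closed) x∈S g∈S =
    ⁻¹-closed _ (∙-closed _ _ (⁻¹-closed _ x∈S) g∈S)

  subgroup-partner⁻ : ∀ {S} → IsSubgroup S → ∀ {x g} →
                      S g ≡ true → S ((x ⁻¹ ∙ g) ⁻¹) ≡ true → S x ≡ true
  subgroup-partner⁻ {S} (_ , ∙-closed , _) {x} {g} g∈S y∈S =
    subst (λ z → S z ≡ true) x≡g∙y (∙-closed _ _ g∈S y∈S)
    where
    x≡g∙y : g ∙ (x ⁻¹ ∙ g) ⁻¹ ≡ x
    x≡g∙y = trans (cong (g ∙_) (⁻¹-anti-homo-\\ x g)) (\\-leftDividesˡ g x)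

  ⊛-othersInv-≡0 : ∀ {m} (D : Fin m → Subset) (j : Fin m) {g} →
                   (∀ x i → i ≢ j → D j x ≡ true → D i ((x ⁻¹ ∙ g) ⁻¹) ≡ false) →
                   (⟦ D j ⟧ ⊛ othersInv D j) g ≡ 0
  ⊛-othersInv-≡0 {m} D j {g} no-partner = sum-map-≡0 term elems
    where
    term : ∀ x → ⟦ D j ⟧ x * othersInv D j (x ⁻¹ ∙ g) ≡ 0
    term x with D j x in x∈Dj
    ... | false = refl
    ... | true  = trans (*-identityˡ _) (sum-map-≡0 summand (allFin m))
      where
      summand : ∀ i → (if does (i Fin.≟ j) then 0 else (⟦ D i ⟧ ⁽⁻¹⁾) (x ⁻¹ ∙ g)) ≡ 0
      summand i with i Fin.≟ j
      ... | yes _   = refl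
      ... | no i≢j = cong (λ b → if b then 1 else 0) (no-partner x i i≢j x∈Dj)

  λ[G-1]-nonzero : ∀ {l g} → 1 ≤ l → g ≢ ε → λ[G-1] l g ≢ 0
  λ[G-1]-nonzero {g = g} (s≤s z≤n) g≢ε with g ≟ ε
  ... | yes g≡ε = contradiction g≡ε g≢ε
  ... | no _    = λ ()

  module _ {v m k l} {D : Fin m → Subset} (sedf : IsSEDF v m k l D) where
    open IsSEDF sedf

    sedf-partner : ∀ j {g} → g ≢ ε →
                   ¬ (∀ x i → i ≢ j → D j x ≡ true → D i ((x ⁻¹ ∙ g) ⁻¹) ≡ false)
    sedf-partner j g≢ε no-partner =
      λ[G-1]-nonzero 1≤l g≢ε (trans (sym (equation j _)) (⊛-othersInv-≡0 D j no-partner))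

    sedf-member : ∀ i → ∃ λ x → D i x ≡ true
    sedf-member i = 1≤∣∣⇒member (D i) (subst (1 ≤_) (sym (size i)) 1≤k)

    module _ (ε∉D : ∀ i → D i ε ≡ false) where

      member-≢ε : ∀ {i x} → D i x ≡ true → x ≢ ε
      member-≢ε {i} x∈Di refl = contradiction (trans (sym x∈Di) (ε∉D i)) λ ()

      withOne-not-subgroup : ∀ j → ¬ IsSubgroup (withOne (D j))
      withOne-not-subgroup j H with sedf-member j
      ... | a , a∈Dj = sedf-partner j (member-≢ε a∈Dj) λ x i i≢j x∈Dj →
        outside-others i≢j (subgroup-partner H (cong (_∨ _) x∈Dj) (cong (_∨ _) a∈Dj))
        where
        outside-others : ∀ {i y} → i ≢ j → withOne (D j) y ≡ true → D i y ≡ false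
        outside-others {i} {y} i≢j y∈H with withOne-true⁻ (D j) y y∈H
        ... | inj₁ y∈Dj = disjoint j i (λ j≡i → i≢j (sym j≡i)) y y∈Dj
        ... | inj₂ refl = ε∉D i

      compl-not-subgroup : ∀ j → ¬ IsSubgroup (compl (D j))
      compl-not-subgroup j K with other-index 2≤m j
      ... | i , i≢j with sedf-member i
      ... | c , c∈Di = sedf-partner j (member-≢ε c∈Di) λ x i' i'≢j x∈Dj →
        ¬-not λ y∈Di' → contradiction
          (subgroup-partner⁻ K (outside-Dj i≢j c∈Di) (outside-Dj i'≢j y∈Di'))
          λ x∈K → not-¬ x∈Dj (compl-true⁻ (D j) x x∈K)
        where
        outside-Dj : ∀ {i y} → i ≢ j → D i y ≡ true → compl (D j) y ≡ true
        outside-Dj {i} i≢j y∈Di = cong not (disjoint i j i≢j _ y∈Di)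

lemma2p3 : (G : FinAbGroup) → let open FinAbGroup G in
    (v m k l : ℕ) (D : Fin m → Subset) →
    IsSEDF v m k l D →
    1 < k →
    (∀ i → D i ε ≡ false) →
    ∀ j → ¬ IsSubgroup (withOne (D j)) × ¬ IsSubgroup (compl (D j))
lemma2p3 G v m k l D sedf _ ε∉D j =
  withOne-not-subgroup G sedf ε∉D j , compl-not-subgroup G sedf ε∉D j
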